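{- Equipped with the maps $\Psi_{G,H}$ and $\Psi_\bullet$ defined in the context, the functor $U\Upsilon^{\diamond}$ is a strong symmetric monoidal functor from $(\mathfrak R,\blacksquare,\check V^{\diamond}(\{1\}))$ (with unitors $\check\rho,\check\lambda$, associator $\check\alpha$, symmetry $\check\gamma$) to $(\mathfrak M,\Box,V^{\diamond}(\{1\}))$ (with unitors $r,\ell$, associator $a$, symmetry $c$).
   Context: Incidence hypergraphs: $G=(\check V(G),\check E(G),I(G),\varsigma_G:I(G)\to\check V(G),\omega_G:I(G)\to\check E(G))$; homomorphisms are triples of functions commuting with $\varsigma,\omega$; category $\mathfrak R$. Laplacian product: $\check V(G\blacksquare H)=(\{1\}\times\check V(G)\times\check V(H))\cup(\{4\}\times\check E(G)\times\check E(H))$, $\check E(G\blacksquare H)=(\{2\}\times\check E(G)\times\check V(H))\cup(\{3\}\times\check V(G)\times\check E(H))$, $I(G\blacksquare H)=(\{1\}\times I(G)\times\check V(H))\cup(\{2\}\times I(G)\times\check E(H))\cup(\{3\}\times\check E(G)\times I(H))\cup(\{4\}\times\check V(G)\times I(H))$, $\varsigma(1,x,y)=(1,\varsigma_G x,y)$, $\varsigma(2,x,y)=(4,\omega_G x,y)$, $\varsigma(3,x,y)=(4,x,\omega_H y)$, $\varsigma(4,x,y)=(1,x,\varsigma_H y)$, $\omega(1,x,y)=(2,\omega_G x,y)$, $\omega(2,x,y)=(3,\varsigma_G x,y)$, $\omega(3,x,y)=(2,x,\varsigma_H y)$, $\omega(4,x,y)=(3,x,\omega_H y)$; on morphisms componentwise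 (vertex-type components via $\check V$, edge-type via $\check E$, incidence-type via $I$). Unit $\check V^\diamond(\{1\})$: one vertex $1$, nothing else. Structure maps: $\check\rho_G:G\blacksquare\check V^\diamond(\{1\})\to G$: $(1,v,1)\mapsto v$, $(2,e,1)\mapsto e$, $(1,i,1)\mapsto i$; $\check\lambda_G:\check V^\diamond(\{1\})\blacksquare G\to G$: $(1,1,v)\mapsto v$, $(3,1,e)\mapsto e$, $(4,1,i)\mapsto i$; $\check\gamma_{G,H}:G\blacksquare H\to H\blacksquare G$: vertices $(n,x,y)\mapsto(n,y,x)$, edges and incidences $(n,x,y)\mapsto(5-n,y,x)$; $\check\alpha_{G,H,K}:(G\blacksquare H)\blacksquare K\to G\blacksquare(H\blacksquare K)$: vertices $(1,(1,v,w),u)\mapsto(1,v,(1,w,u))$, $(1,(4,e,f),u)\mapsto(4,e,(2,f,u))$, $(4,(2,e,w),g)\mapsto(4,e,(3,w,g))$, $(4,(3,v,f),g)\mapsto(1,v,(4,f,g))$; edges $(2,(2,e,w),u)\mapsto(2,e,(1,w,u))$, $(2,(3,v,f),u)\mapsto(3,v,(2,f,u))$, $(3,(1,v,w),g)\mapsto(3,v,(3,w,g))$, $(3,(4,e,f),g)\mapsto(2,e,(4,f,g))$; incidences $(1,(1,i,w),u)\mapsto(1,i,(1,w,u))$, $(1,(2,i,f),u)\mapsto(2,i,(2,f,u))$, $(1,(3,e,j),u)\mapsto(3,e,(3,j,u))$, $(1,(4,v,j),u)\mapsto(4,v,(4,j,u))$, $(2,(1,i,w),g)\mapsto(2,i,(3,w,g))$,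 $(2,(2,i,f),g)\mapsto(1,i,(4,f,g))$, $(2,(3,e,j),g)\mapsto(3,e,(2,j,g))$, $(2,(4,v,j),g)\mapsto(4,v,(2,j,g))$, $(3,(2,e,w),k)\mapsto(3,e,(4,w,k))$, $(3,(3,v,f),k)\mapsto(4,v,(3,f,k))$, $(4,(1,v,w),k)\mapsto(4,v,(4,w,k))$, $(4,(4,e,f),k)\mapsto(3,e,(3,f,k))$. Multigraphs: a multigraph $G$ is $(V(G),E(G),\epsilon_G)$ with $\epsilon_G:E(G)\to\mathcal P V(G)$ and $1\le|\epsilon_G(e)|\le 2$ for all $e$; a homomorphism $\phi$ is a pair of functions $V(\phi),E(\phi)$ with $\epsilon_H(E(\phi)(e))=V(\phi)[\epsilon_G(e)]$; category $\mathfrak M$. Box product: $V(G\Box H)=V(G)\times V(H)$, $E(G\Box H)=(\{1\}\times E(G)\times V(H))\cup(\{2\}\times V(G)\times E(H))$, $\epsilon(1,x,y)=\epsilon_G(x)\times\{y\}$, $\epsilon(2,x,y)=\{x\}\times\epsilon_H(y)$; $(\phi\Box\psi)$ acts by $(v,w)\mapsto(V\phi(v),V\psi(w))$, $(1,x,y)\mapsto(1,E\phi(x),V\psi(y))$, $(2,x,y)\mapsto(2,V\phi(x),E\psi(y))$. Unit $V^\diamond(\{1\})$: one vertex $1$, no edges. Structure maps: $r_G(v,1)=v$, $r_G(1,e,1)=e$; $\ell_G(1,v)=v$, $\ell_G(2,1,e)=e$; $c_{G,H}(v,w)=(w,v)$, $c_{G,H}(n,x,y)=(3-n,y,x)$;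 $a_{G,H,K}((v,w),u)=(v,(w,u))$, $a(1,(1,e,w),u)=(1,e,(w,u))$, $a(1,(2,v,f),u)=(2,v,(1,f,u))$, $a(2,(v,w),g)=(2,v,(2,w,g))$. The functor $U\Upsilon^\diamond:\mathfrak R\to\mathfrak M$ (bipartite incidence graph): $V(U\Upsilon^\diamond G)=(\{1\}\times\check V(G))\cup(\{2\}\times\check E(G))$, $E(U\Upsilon^\diamond G)=I(G)$, $\epsilon(i)=\{(1,\varsigma_G(i)),(2,\omega_G(i))\}$; on morphisms $(1,v)\mapsto(1,\check V\phi(v))$, $(2,e)\mapsto(2,\check E\phi(e))$, $i\mapsto I\phi(i)$. Structure maps: $\Psi_{G,H}:U\Upsilon^\diamond(G)\Box U\Upsilon^\diamond(H)\to U\Upsilon^\diamond(G\blacksquare H)$ with $V(\Psi)((1,v),(1,w))=(1,(1,v,w))$, $V(\Psi)((2,e),(1,w))=(2,(2,e,w))$, $V(\Psi)((1,v),(2,f))=(2,(3,v,f))$, $V(\Psi)((2,e),(2,f))=(1,(4,e,f))$, $E(\Psi)(1,i,(1,w))=(1,i,w)$, $E(\Psi)(1,i,(2,f))=(2,i,f)$, $E(\Psi)(2,(1,v),j)=(4,v,j)$, $E(\Psi)(2,(2,e),j)=(3,e,j)$; and $\Psi_\bullet:V^\diamond(\{1\})\to U\Upsilon^\diamond(\check V^\diamond(\{1\}))$ with $V(\Psi_\bullet)(1)=(1,1)$. Strong symmetric monoidal means: $\Psi$ is natural, $\Psi_{G,H}$ and $\Psi_\bullet$ are isomorphisms, and the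 standard associativity, left/right unitality and symmetry coherence diagrams commute. -}

module Defs where

open import Data.Unit using (⊤; tt)
open import Data.Empty using (⊥)
open import Data.Product using (Σ; _×_; _,_; proj₁; proj₂)
open import Data.Sum using (_⊎_; inj₁; inj₂)
open import Relation.Binary.PropositionalEquality using (_≡_; refl)

Subset : Set → Set₁
Subset X = X → Set

_≐_ : {X : Set} → Subset X → Subset X → Set
S ≐ T = (∀ x → S x → T x) × (∀ x → T x → S x)

image : {X Y : Set} → (X → Y) → Subset X → Subset Y
image {X} f S y = Σ X λ x → S x × f x ≡ y

-- 1 ≤ |S| ≤ 2 : S = {x , y} for some x, y (possibly equal)
OneOrTwo : {X : Set} → Subset X → Set
OneOrTwo {X} S = Σ X λ x → Σ X λ y → S ≐ (λ z → (z ≡ x) ⊎ (z ≡ y))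

-- Incidence hypergraphs (category 𝔑)

record IHG : Set₁ where
  field
    V : Set
    E : Set
    I : Set
    ς : I → V
    ω : I → E
open IHG public

record IFun (G H : IHG) : Set where
  constructor ifun
  field
    hV : V G → V H
    hE : E G → E H
    hI : I G → I H
open IFun public

record IHom (G H : IHG) : Set where
  field
    fun : IFun G H
    ς-comm : ∀ i → ς H (hI fun i) ≡ hV fun (ς G i)
    ω-comm : ∀ i → ω H (hI fun i) ≡ hE fun (ω G i)
open IHom public

-- Laplacian product; constructor names carry the tags 1..4
data LV (G H : IHG) : Set where
  lv1 : V G → V H → LV G H
  lv4 : E G → E H → LV G H

data LE (G H : IHG) : Set where
  le2 : E G → V H → LE G H
  le3 : V G → E H → LE G H

data LI (G H : IHG) : Set where
  li1 : I G → V H → LI G H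
  li2 : I G → E H → LI G H
  li3 : E G → I H → LI G H
  li4 : V G → I H → LI G H

module _ {G H : IHG} where
  Lς : LI G H → LV G H
  Lς (li1 x y) = lv1 (ς G x) y
  Lς (li2 x y) = lv4 (ω G x) y
  Lς (li3 x y) = lv4 x (ω H y)
  Lς (li4 x y) = lv1 x (ς H y)

  Lω : LI G H → LE G H
  Lω (li1 x y) = le2 (ω G x) y
  Lω (li2 x y) = le3 (ς G x) y
  Lω (li3 x y) = le2 x (ς H y)
  Lω (li4 x y) = le3 x (ω H y)

_■_ : IHG → IHG → IHG
G ■ H = record { V = LV G H ; E = LE G H ; I = LI G H ; ς = Lς ; ω = Lω }

_■₁_ : {G G' H H' : IHG} → IFun G G' → IFun H H' → IFun (G ■ H) (G' ■ H')
φ ■₁ ψ = ifun fv fe fi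
  where
  fv : _
  fv (lv1 x y) = lv1 (hV φ x) (hV ψ y)
  fv (lv4 x y) = lv4 (hE φ x) (hE ψ y)
  fe : _
  fe (le2 x y) = le2 (hE φ x) (hV ψ y)
  fe (le3 x y) = le3 (hV φ x) (hE ψ y)
  fi : _
  fi (li1 x y) = li1 (hI φ x) (hV ψ y)
  fi (li2 x y) = li2 (hI φ x) (hE ψ y)
  fi (li3 x y) = li3 (hE φ x) (hI ψ y)
  fi (li4 x y) = li4 (hV φ x) (hI ψ y)

Ǔnit : IHG
Ǔnit = record { V = ⊤ ; E = ⊥ ; I = ⊥ ; ς = λ () ; ω = λ () }

ρ̌ : (G : IHG) → IFun (G ■ Ǔnit) G
ρ̌ G = ifun fv fe fi
  where
  fv : _
  fv (lv1 v tt) = v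
  fv (lv4 e ())
  fe : _
  fe (le2 e tt) = e
  fe (le3 v ())
  fi : _
  fi (li1 i tt) = i
  fi (li2 i ())
  fi (li3 e ())
  fi (li4 v ())

λ̌ : (G : IHG) → IFun (Ǔnit ■ G) G
λ̌ G = ifun fv fe fi
  where
  fv : _
  fv (lv1 tt v) = v
  fv (lv4 () f)
  fe : _
  fe (le2 () w)
  fe (le3 tt e) = e
  fi : _
  fi (li1 () w)
  fi (li2 () f)
  fi (li3 () j)
  fi (li4 tt i) = i

γ̌ : (G H : IHG) → IFun (G ■ H) (H ■ G)
γ̌ G H = ifun fv fe fi
  where
  fv : _
  fv (lv1 x y) = lv1 y x
  fv (lv4 x y) = lv4 y x
  fe : _
  fe (le2 x y) = le3 y x
  fe (le3 x y) = le2 y x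
  fi : _
  fi (li1 x y) = li4 y x
  fi (li2 x y) = li3 y x
  fi (li3 x y) = li2 y x
  fi (li4 x y) = li1 y x

α̌ : (G H K : IHG) → IFun ((G ■ H) ■ K) (G ■ (H ■ K))
α̌ G H K = ifun fv fe fi
  where
  fv : _
  fv (lv1 (lv1 v w) u) = lv1 v (lv1 w u)
  fv (lv1 (lv4 e f) u) = lv4 e (le2 f u)
  fv (lv4 (le2 e w) g) = lv4 e (le3 w g)
  fv (lv4 (le3 v f) g) = lv1 v (lv4 f g)
  fe : _
  fe (le2 (le2 e w) u) = le2 e (lv1 w u)
  fe (le2 (le3 v f) u) = le3 v (le2 f u)
  fe (le3 (lv1 v w) g) = le3 v (le3 w g)
  fe (le3 (lv4 e f) g) = le2 e (lv4 f g)
  fi : _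
  fi (li1 (li1 i w) u) = li1 i (lv1 w u)
  fi (li1 (li2 i f) u) = li2 i (le2 f u)
  fi (li1 (li3 e j) u) = li3 e (li1 j u)
  fi (li1 (li4 v j) u) = li4 v (li1 j u)
  fi (li2 (li1 i w) g) = li2 i (le3 w g)
  fi (li2 (li2 i f) g) = li1 i (lv4 f g)
  fi (li2 (li3 e j) g) = li3 e (li2 j g)
  fi (li2 (li4 v j) g) = li4 v (li2 j g)
  fi (li3 (le2 e w) k) = li3 e (li4 w k)
  fi (li3 (le3 v f) k) = li4 v (li3 f k)
  fi (li4 (lv1 v w) k) = li4 v (li4 w k)
  fi (li4 (lv4 e f) k) = li3 e (li3 f k)

-- Multigraphs (category 𝔐)

record MG : Set₁ where
  field
    V : Set
    E : Set
    ε : E → Subset V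
    ε-card : ∀ e → OneOrTwo (ε e)
open MG public

record MFun (G H : MG) : Set where
  constructor mfun
  field
    fV : MG.V G → MG.V H
    fE : MG.E G → MG.E H
open MFun public

IsMHom : {G H : MG} → MFun G H → Set
IsMHom {G} {H} φ = ∀ e → ε H (fE φ e) ≐ image (fV φ) (ε G e)

idᴹ : (G : MG) → MFun G G
idᴹ G = mfun (λ x → x) (λ x → x)

_∘ᴹ_ : {G H K : MG} → MFun H K → MFun G H → MFun G K
g ∘ᴹ f = mfun (λ x → fV g (fV f x)) (λ x → fE g (fE f x))

_≈ᴹ_ : {G H : MG} → MFun G H → MFun G H → Set
f ≈ᴹ g = (∀ v → fV f v ≡ fV g v) × (∀ e → fE f e ≡ fE g e)

IsIsoᴹ : {G H : MG} → MFun G H → Set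
IsIsoᴹ {G} {H} f =
  IsMHom f × Σ (MFun H G) (λ g → IsMHom g × ((g ∘ᴹ f) ≈ᴹ idᴹ G) × ((f ∘ᴹ g) ≈ᴹ idᴹ H))

data BE (G H : MG) : Set where
  b1 : MG.E G → MG.V H → BE G H
  b2 : MG.V G → MG.E H → BE G H

module _ {G H : MG} where
  Bε : BE G H → Subset (MG.V G × MG.V H)
  Bε (b1 x y) (a , b) = ε G x a × b ≡ y
  Bε (b2 x y) (a , b) = a ≡ x × ε H y b

  Bε-card : ∀ e → OneOrTwo (Bε e)
  Bε-card (b1 x y) with ε-card G x
  ... | (p , q , to , from) = (p , y) , (q , y) , t , f
    where
    t : _
    t (a , .y) (m , refl) with to a m
    ... | inj₁ refl = inj₁ refl
    ... | inj₂ refl = inj₂ refl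
    f : _
    f .(p , y) (inj₁ refl) = from p (inj₁ refl) , refl
    f .(q , y) (inj₂ refl) = from q (inj₂ refl) , refl
  Bε-card (b2 x y) with ε-card H y
  ... | (p , q , to , from) = (x , p) , (x , q) , t , f
    where
    t : _
    t (.x , b) (refl , m) with to b m
    ... | inj₁ refl = inj₁ refl
    ... | inj₂ refl = inj₂ refl
    f : _
    f .(x , p) (inj₁ refl) = refl , from p (inj₁ refl)
    f .(x , q) (inj₂ refl) = refl , from q (inj₂ refl)

_□_ : MG → MG → MG
G □ H = record { V = MG.V G × MG.V H ; E = BE G H ; ε = Bε ; ε-card = Bε-card }

_□₁_ : {G G' H H' : MG} → MFun G G' → MFun H H' → MFun (G □ H) (G' □ H')
φ □₁ ψ = mfun (λ { (v , w) → fV φ v , fV ψ w }) fe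
  where
  fe : _
  fe (b1 x y) = b1 (fE φ x) (fV ψ y)
  fe (b2 x y) = b2 (fV φ x) (fE ψ y)

Unit : MG
Unit = record { V = ⊤ ; E = ⊥ ; ε = λ () ; ε-card = λ () }

r : (G : MG) → MFun (G □ Unit) G
r G = mfun proj₁ fe
  where
  fe : _
  fe (b1 e tt) = e
  fe (b2 v ())

ℓ : (G : MG) → MFun (Unit □ G) G
ℓ G = mfun proj₂ fe
  where
  fe : _
  fe (b1 () w)
  fe (b2 tt e) = e

c : (G H : MG) → MFun (G □ H) (H □ G)
c G H = mfun (λ { (v , w) → w , v }) fe
  where
  fe : _
  fe (b1 x y) = b2 y x
  fe (b2 x y) = b1 y x

a : (G H K : MG) → MFun ((G □ H) □ K) (G □ (H □ K))
a G H K = mfun (λ { ((v , w) , u) → v , (w , u) }) fe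
  where
  fe : _
  fe (b1 (b1 e w) u) = b1 e (w , u)
  fe (b1 (b2 v f) u) = b2 v (b1 f u)
  fe (b2 (v , w) g) = b2 v (b2 w g)

-- The functor UΥ◇ (bipartite incidence graph); tag 1 = inj₁, tag 2 = inj₂

UΥ : IHG → MG
UΥ G = record
  { V = IHG.V G ⊎ IHG.E G
  ; E = I G
  ; ε = λ i z → (z ≡ inj₁ (ς G i)) ⊎ (z ≡ inj₂ (ω G i))
  ; ε-card = λ i → inj₁ (ς G i) , inj₂ (ω G i) , (λ _ p → p) , (λ _ p → p)
  }

UΥ₁ : {G H : IHG} → IFun G H → MFun (UΥ G) (UΥ H)
UΥ₁ φ = mfun fv (hI φ)
  where
  fv : _
  fv (inj₁ v) = inj₁ (hV φ v)
  fv (inj₂ e) = inj₂ (hE φ e)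

Ψ : (G H : IHG) → MFun (UΥ G □ UΥ H) (UΥ (G ■ H))
Ψ G H = mfun fv fe
  where
  fv : _
  fv (inj₁ v , inj₁ w) = inj₁ (lv1 v w)
  fv (inj₂ e , inj₁ w) = inj₂ (le2 e w)
  fv (inj₁ v , inj₂ f) = inj₂ (le3 v f)
  fv (inj₂ e , inj₂ f) = inj₁ (lv4 e f)
  fe : _
  fe (b1 i (inj₁ w)) = li1 i w
  fe (b1 i (inj₂ f)) = li2 i f
  fe (b2 (inj₁ v) j) = li4 v j
  fe (b2 (inj₂ e) j) = li3 e j

Ψ• : MFun Unit (UΥ Ǔnit)
Ψ• = mfun (λ _ → inj₁ tt) (λ ())

Naturality : Set₁
Naturality = ∀ {G G' H H' : IHG} (φ : IHom G G') (ψ : IHom H H') →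
  (UΥ₁ (fun φ ■₁ fun ψ) ∘ᴹ Ψ G H) ≈ᴹ (Ψ G' H' ∘ᴹ (UΥ₁ (fun φ) □₁ UΥ₁ (fun ψ)))

Associativity : Set₁
Associativity = ∀ (G H K : IHG) →
  (UΥ₁ (α̌ G H K) ∘ᴹ (Ψ (G ■ H) K ∘ᴹ (Ψ G H □₁ idᴹ (UΥ K))))
  ≈ᴹ (Ψ G (H ■ K) ∘ᴹ ((idᴹ (UΥ G) □₁ Ψ H K) ∘ᴹ a (UΥ G) (UΥ H) (UΥ K)))

LeftUnitality : Set₁
LeftUnitality = ∀ (G : IHG) →
  (UΥ₁ (λ̌ G) ∘ᴹ (Ψ Ǔnit G ∘ᴹ (Ψ• □₁ idᴹ (UΥ G)))) ≈ᴹ ℓ (UΥ G)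

RightUnitality : Set₁
RightUnitality = ∀ (G : IHG) →
  (UΥ₁ (ρ̌ G) ∘ᴹ (Ψ G Ǔnit ∘ᴹ (idᴹ (UΥ G) □₁ Ψ•))) ≈ᴹ r (UΥ G)

Symmetry : Set₁
Symmetry = ∀ (G H : IHG) →
  (UΥ₁ (γ̌ G H) ∘ᴹ Ψ G H) ≈ᴹ (Ψ H G ∘ᴹ c (UΥ G) (UΥ H))

IsStrongSymmetricMonoidal : Set₁
IsStrongSymmetricMonoidal =
  Naturality
  × (∀ (G H : IHG) → IsIsoᴹ (Ψ G H))
  × IsIsoᴹ Ψ•
  × Associativity
  × LeftUnitality
  × RightUnitality
  × Symmetry

module Submission where

open import Defs
open import Data.Unit using (tt)
open import Data.Product using (_,_; proj₁; proj₂)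
open import Data.Sum using (_⊎_; inj₁; inj₂)
open import Relation.Binary.PropositionalEquality using (_≡_; refl; sym; subst)

-- The vertex and edge maps of Ψ only re-tag components, so naturality, the
-- coherence squares and the two-sided inverse all hold on the nose, case by
-- case.  The real content is that Ψ G H is a homomorphism: it sends the two
-- endpoints of a box edge to the two ends ς, ω of the corresponding incidence;
-- its inverse is then a homomorphism too, as for any bijective homomorphism
-- of multigraphs.

Pair : {X : Set} → X → X → Subset X
Pair x y z = (z ≡ x) ⊎ (z ≡ y)

module _ {X : Set} where

  ≐-refl : {S : Subset X} → S ≐ S
  ≐-refl = (λ _ p → p) , (λ _ p → p)

  ≐-sym : {S T : Subset X} → S ≐ T → T ≐ S
  ≐-sym (to , from) = from , to

  ≐-trans : {S T U : Subset X} → S ≐ T → T ≐ U → S ≐ U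
  ≐-trans (to , from) (to′ , from′) =
    (λ x p → to′ x (to x p)) , (λ x p → from x (from′ x p))

  Pair-swap : {x y : X} → Pair x y ≐ Pair y x
  Pair-swap = swap , swap
    where
    swap : {x y : X} → ∀ z → Pair x y z → Pair y x z
    swap _ (inj₁ p) = inj₂ p
    swap _ (inj₂ p) = inj₁ p

module _ {X Y : Set} (f : X → Y) where

  image-resp-≐ : {S T : Subset X} → S ≐ T → image f S ≐ image f T
  image-resp-≐ (to , from) =
    (λ { _ (x , m , eq) → x , to x m , eq })
    , (λ { _ (x , m , eq) → x , from x m , eq })

  image-Pair : {x y : X} → image f (Pair x y) ≐ Pair (f x) (f y)
  image-Pair {x} {y} = to , from
    where
    to : ∀ z → image f (Pair x y) z → Pair (f x) (f y) z
    to _ (_ , inj₁ refl , refl) = inj₁ refl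
    to _ (_ , inj₂ refl , refl) = inj₂ refl
    from : ∀ z → Pair (f x) (f y) z → image f (Pair x y) z
    from _ (inj₁ refl) = x , inj₁ refl , refl
    from _ (inj₂ refl) = y , inj₂ refl , refl

module _ {G H : MG} where

  Bε-b1-Pair : ∀ {p q} e y → ε G e ≐ Pair p q →
               Bε {G} {H} (b1 e y) ≐ Pair (p , y) (q , y)
  Bε-b1-Pair {p} {q} e y (to , from) = to′ , from′
    where
    to′ : ∀ z → Bε {G} {H} (b1 e y) z → Pair (p , y) (q , y) z
    to′ (x , .y) (m , refl) with to x m
    ... | inj₁ refl = inj₁ refl
    ... | inj₂ refl = inj₂ refl
    from′ : ∀ z → Pair (p , y) (q , y) z → Bε {G} {H} (b1 e y) z
    from′ _ (inj₁ refl) = from p (inj₁ refl) , refl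
    from′ _ (inj₂ refl) = from q (inj₂ refl) , refl

  Bε-b2-Pair : ∀ {p q} x e → ε H e ≐ Pair p q →
               Bε {G} {H} (b2 x e) ≐ Pair (x , p) (x , q)
  Bε-b2-Pair {p} {q} x e (to , from) = to′ , from′
    where
    to′ : ∀ z → Bε {G} {H} (b2 x e) z → Pair (x , p) (x , q) z
    to′ (.x , y) (refl , m) with to y m
    ... | inj₁ refl = inj₁ refl
    ... | inj₂ refl = inj₂ refl
    from′ : ∀ z → Pair (x , p) (x , q) z → Bε {G} {H} (b2 x e) z
    from′ _ (inj₁ refl) = refl , from p (inj₁ refl)
    from′ _ (inj₂ refl) = refl , from q (inj₂ refl)

module _ {G H : MG} (f : MFun G H) (g : MFun H G)
         (g∘f≈id : (g ∘ᴹ f) ≈ᴹ idᴹ G) (f∘g≈id : (f ∘ᴹ g) ≈ᴹ idᴹ H) where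

  inverse-isMHom : IsMHom f → IsMHom g
  inverse-isMHom f-hom e = to , from
    where
    endpoints : ε H e ≐ image (fV f) (ε G (fE g e))
    endpoints = subst (λ e′ → ε H e′ ≐ image (fV f) (ε G (fE g e)))
                      (proj₂ f∘g≈id e) (f-hom (fE g e))
    to : ∀ x → ε G (fE g e) x → image (fV g) (ε H e) x
    to x m = fV f x , proj₂ endpoints (fV f x) (x , m , refl) , proj₁ g∘f≈id x
    from : ∀ x → image (fV g) (ε H e) x → ε G (fE g e) x
    from _ (y , m , refl) with proj₁ endpoints y m
    ... | x , m′ , refl = subst (ε G (fE g e)) (sym (proj₁ g∘f≈id x)) m′

  isIsoᴹ-fromInverse : IsMHom f → IsIsoᴹ f
  isIsoᴹ-fromInverse f-hom =
    f-hom , g , inverse-isMHom f-hom , g∘f≈id , f∘g≈id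

module _ {G H : MG} where

  _≈ⱽ_ : MFun G H → MFun G H → Set
  f ≈ⱽ g = ∀ v → fV f v ≡ fV g v

  _≈ᴱ_ : MFun G H → MFun G H → Set
  f ≈ᴱ g = ∀ e → fE f e ≡ fE g e

Ψ-natural : Naturality
Ψ-natural {G} {G′} {H} {H′} φ ψ = onVertices , onEdges
  where
  onVertices : (UΥ₁ (fun φ ■₁ fun ψ) ∘ᴹ Ψ G H)
    ≈ⱽ (Ψ G′ H′ ∘ᴹ (UΥ₁ (fun φ) □₁ UΥ₁ (fun ψ)))
  onVertices (inj₁ v , inj₁ w) = refl
  onVertices (inj₂ e , inj₁ w) = refl
  onVertices (inj₁ v , inj₂ f) = refl
  onVertices (inj₂ e , inj₂ f) = refl
  onEdges : (UΥ₁ (fun φ ■₁ fun ψ) ∘ᴹ Ψ G H)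
    ≈ᴱ (Ψ G′ H′ ∘ᴹ (UΥ₁ (fun φ) □₁ UΥ₁ (fun ψ)))
  onEdges (b1 i (inj₁ w)) = refl
  onEdges (b1 i (inj₂ f)) = refl
  onEdges (b2 (inj₁ v) j) = refl
  onEdges (b2 (inj₂ e) j) = refl

module _ (G H : IHG) where

  Ψ⁻¹ : MFun (UΥ (G ■ H)) (UΥ G □ UΥ H)
  Ψ⁻¹ = mfun onVertices onEdges
    where
    onVertices : MG.V (UΥ (G ■ H)) → MG.V (UΥ G □ UΥ H)
    onVertices (inj₁ (lv1 v w)) = inj₁ v , inj₁ w
    onVertices (inj₁ (lv4 e f)) = inj₂ e , inj₂ f
    onVertices (inj₂ (le2 e w)) = inj₂ e , inj₁ w
    onVertices (inj₂ (le3 v f)) = inj₁ v , inj₂ f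
    onEdges : MG.E (UΥ (G ■ H)) → MG.E (UΥ G □ UΥ H)
    onEdges (li1 i w) = b1 i (inj₁ w)
    onEdges (li2 i f) = b1 i (inj₂ f)
    onEdges (li3 e j) = b2 (inj₂ e) j
    onEdges (li4 v j) = b2 (inj₁ v) j

  Ψ⁻¹∘Ψ≈id : (Ψ⁻¹ ∘ᴹ Ψ G H) ≈ᴹ idᴹ (UΥ G □ UΥ H)
  Ψ⁻¹∘Ψ≈id = onVertices , onEdges
    where
    onVertices : (Ψ⁻¹ ∘ᴹ Ψ G H) ≈ⱽ (idᴹ (UΥ G □ UΥ H))
    onVertices (inj₁ v , inj₁ w) = refl
    onVertices (inj₂ e , inj₁ w) = refl
    onVertices (inj₁ v , inj₂ f) = refl
    onVertices (inj₂ e , inj₂ f) = refl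
    onEdges : (Ψ⁻¹ ∘ᴹ Ψ G H) ≈ᴱ (idᴹ (UΥ G □ UΥ H))
    onEdges (b1 i (inj₁ w)) = refl
    onEdges (b1 i (inj₂ f)) = refl
    onEdges (b2 (inj₁ v) j) = refl
    onEdges (b2 (inj₂ e) j) = refl

  Ψ∘Ψ⁻¹≈id : (Ψ G H ∘ᴹ Ψ⁻¹) ≈ᴹ idᴹ (UΥ (G ■ H))
  Ψ∘Ψ⁻¹≈id = onVertices , onEdges
    where
    onVertices : (Ψ G H ∘ᴹ Ψ⁻¹) ≈ⱽ (idᴹ (UΥ (G ■ H)))
    onVertices (inj₁ (lv1 v w)) = refl
    onVertices (inj₁ (lv4 e f)) = refl
    onVertices (inj₂ (le2 e w)) = refl
    onVertices (inj₂ (le3 v f)) = refl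
    onEdges : (Ψ G H ∘ᴹ Ψ⁻¹) ≈ᴱ (idᴹ (UΥ (G ■ H)))
    onEdges (li1 i w) = refl
    onEdges (li2 i f) = refl
    onEdges (li3 e j) = refl
    onEdges (li4 v j) = refl

  image-Ψ-Pair : ∀ {S x y} → S ≐ Pair x y →
                 image (fV (Ψ G H)) S ≐ Pair (fV (Ψ G H) x) (fV (Ψ G H) y)
  image-Ψ-Pair S≐xy =
    ≐-trans (image-resp-≐ (fV (Ψ G H)) S≐xy) (image-Pair (fV (Ψ G H)))

  -- Tags 2 and 3 of the Laplacian product list the ends of an incidence in the
  -- opposite order to the box-product endpoints, hence the swaps.
  Ψ-isMHom : IsMHom (Ψ G H)
  Ψ-isMHom (b1 i (inj₁ w)) =
    ≐-sym (image-Ψ-Pair (Bε-b1-Pair {UΥ G} {UΥ H} i (inj₁ w) ≐-refl))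
  Ψ-isMHom (b1 i (inj₂ f)) =
    ≐-trans Pair-swap (≐-sym (image-Ψ-Pair (Bε-b1-Pair {UΥ G} {UΥ H} i (inj₂ f) ≐-refl)))
  Ψ-isMHom (b2 (inj₁ v) j) =
    ≐-sym (image-Ψ-Pair (Bε-b2-Pair {UΥ G} {UΥ H} (inj₁ v) j ≐-refl))
  Ψ-isMHom (b2 (inj₂ e) j) =
    ≐-trans Pair-swap (≐-sym (image-Ψ-Pair (Bε-b2-Pair {UΥ G} {UΥ H} (inj₂ e) j ≐-refl)))

  Ψ-isIsoᴹ : IsIsoᴹ (Ψ G H)
  Ψ-isIsoᴹ = isIsoᴹ-fromInverse (Ψ G H) Ψ⁻¹ Ψ⁻¹∘Ψ≈id Ψ∘Ψ⁻¹≈id Ψ-isMHom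

Ψ•-isIsoᴹ : IsIsoᴹ Ψ•
Ψ•-isIsoᴹ =
  isIsoᴹ-fromInverse Ψ• (mfun (λ _ → tt) (λ ()))
    ((λ _ → refl) , (λ ())) (onVertices , (λ ())) (λ ())
  where
  onVertices : (v : MG.V (UΥ Ǔnit)) → inj₁ tt ≡ v
  onVertices (inj₁ tt) = refl
  onVertices (inj₂ ())

Ψ-associative : Associativity
Ψ-associative G H K = onVertices , onEdges
  where
  onVertices : (UΥ₁ (α̌ G H K) ∘ᴹ (Ψ (G ■ H) K ∘ᴹ (Ψ G H □₁ idᴹ (UΥ K))))
    ≈ⱽ (Ψ G (H ■ K) ∘ᴹ ((idᴹ (UΥ G) □₁ Ψ H K) ∘ᴹ a (UΥ G) (UΥ H) (UΥ K)))
  onVertices ((inj₁ v , inj₁ w) , inj₁ u) = refl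
  onVertices ((inj₁ v , inj₁ w) , inj₂ g) = refl
  onVertices ((inj₁ v , inj₂ f) , inj₁ u) = refl
  onVertices ((inj₁ v , inj₂ f) , inj₂ g) = refl
  onVertices ((inj₂ e , inj₁ w) , inj₁ u) = refl
  onVertices ((inj₂ e , inj₁ w) , inj₂ g) = refl
  onVertices ((inj₂ e , inj₂ f) , inj₁ u) = refl
  onVertices ((inj₂ e , inj₂ f) , inj₂ g) = refl
  onEdges : (UΥ₁ (α̌ G H K) ∘ᴹ (Ψ (G ■ H) K ∘ᴹ (Ψ G H □₁ idᴹ (UΥ K))))
    ≈ᴱ (Ψ G (H ■ K) ∘ᴹ ((idᴹ (UΥ G) □₁ Ψ H K) ∘ᴹ a (UΥ G) (UΥ H) (UΥ K)))
  onEdges (b1 (b1 i (inj₁ w)) (inj₁ u)) = refl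
  onEdges (b1 (b1 i (inj₁ w)) (inj₂ g)) = refl
  onEdges (b1 (b1 i (inj₂ f)) (inj₁ u)) = refl
  onEdges (b1 (b1 i (inj₂ f)) (inj₂ g)) = refl
  onEdges (b1 (b2 (inj₁ v) j) (inj₁ u)) = refl
  onEdges (b1 (b2 (inj₁ v) j) (inj₂ g)) = refl
  onEdges (b1 (b2 (inj₂ e) j) (inj₁ u)) = refl
  onEdges (b1 (b2 (inj₂ e) j) (inj₂ g)) = refl
  onEdges (b2 (inj₁ v , inj₁ w) k) = refl
  onEdges (b2 (inj₁ v , inj₂ f) k) = refl
  onEdges (b2 (inj₂ e , inj₁ w) k) = refl
  onEdges (b2 (inj₂ e , inj₂ f) k) = refl

Ψ-leftUnital : LeftUnitality
Ψ-leftUnital G = onVertices , onEdges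
  where
  onVertices : (UΥ₁ (λ̌ G) ∘ᴹ (Ψ Ǔnit G ∘ᴹ (Ψ• □₁ idᴹ (UΥ G)))) ≈ⱽ (ℓ (UΥ G))
  onVertices (tt , inj₁ v) = refl
  onVertices (tt , inj₂ e) = refl
  onEdges : (UΥ₁ (λ̌ G) ∘ᴹ (Ψ Ǔnit G ∘ᴹ (Ψ• □₁ idᴹ (UΥ G)))) ≈ᴱ (ℓ (UΥ G))
  onEdges (b1 () w)
  onEdges (b2 tt i) = refl

Ψ-rightUnital : RightUnitality
Ψ-rightUnital G = onVertices , onEdges
  where
  onVertices : (UΥ₁ (ρ̌ G) ∘ᴹ (Ψ G Ǔnit ∘ᴹ (idᴹ (UΥ G) □₁ Ψ•))) ≈ⱽ (r (UΥ G))
  onVertices (inj₁ v , tt) = refl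
  onVertices (inj₂ e , tt) = refl
  onEdges : (UΥ₁ (ρ̌ G) ∘ᴹ (Ψ G Ǔnit ∘ᴹ (idᴹ (UΥ G) □₁ Ψ•))) ≈ᴱ (r (UΥ G))
  onEdges (b1 i tt) = refl
  onEdges (b2 v ())

Ψ-symmetric : Symmetry
Ψ-symmetric G H = onVertices , onEdges
  where
  onVertices : (UΥ₁ (γ̌ G H) ∘ᴹ Ψ G H) ≈ⱽ (Ψ H G ∘ᴹ c (UΥ G) (UΥ H))
  onVertices (inj₁ v , inj₁ w) = refl
  onVertices (inj₂ e , inj₁ w) = refl
  onVertices (inj₁ v , inj₂ f) = refl
  onVertices (inj₂ e , inj₂ f) = refl
  onEdges : (UΥ₁ (γ̌ G H) ∘ᴹ Ψ G H) ≈ᴱ (Ψ H G ∘ᴹ c (UΥ G) (UΥ H))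
  onEdges (b1 i (inj₁ w)) = refl
  onEdges (b1 i (inj₂ f)) = refl
  onEdges (b2 (inj₁ v) j) = refl
  onEdges (b2 (inj₂ e) j) = refl

mainTheorem5 : IsStrongSymmetricMonoidal
mainTheorem5 =
  Ψ-natural , Ψ-isIsoᴹ , Ψ•-isIsoᴹ ,
  Ψ-associative , Ψ-leftUnital , Ψ-rightUnital , Ψ-symmetric
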